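{- Let $n\ge4$ and let $h$ be odd with $h\ge\frac{3(n-1)}{n-3}$. Then there exists $p\in\mathcal{P}$ such that $D_{\mu(p)}(p)=D_{\mu(p^r)}(p^r)=\{n\}$.
   Context: $N=\{1,\dots,n\}$, $H=\{1,\dots,h\}$, $\mathcal{P}=\mathcal{L}(N)^h$ the set of profiles of linear orders on $N$; $x>_{p_i}y$ means individual $i$ ranks $x$ above $y$; $p^r$ is the profile in which every individual's order is reversed. For integers $\mu$ with $h/2<\mu\le h$, $D_\mu(p)=\{x\in N:\forall y\in N,\ |\{i: y>_{p_i}x\}|<\mu\}$, and $\mu(p)=\min\{\mu\in\mathbb{N}\cap(h/2,h]: D_\mu(p)\ne\varnothing\}$ (well defined). -}

module Defs where

open import Data.Nat using (ℕ; zero; suc; _+_; _*_; _∸_; _<_; _≤_; _<?_)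
open import Data.Fin using (Fin; toℕ; opposite)
open import Data.Fin.Properties using (opposite-involutive)
open import Data.List using (List; length; filter; allFin)
open import Data.Product using (Σ; ∃; _×_; _,_)
open import Function.Definitions using (Injective)
open import Relation.Binary.PropositionalEquality using (_≡_; cong; sym; trans)

-- A linear order on N = {1,…,n} (element i+1 encoded as (i : Fin n)),
-- given by an injective (hence bijective) rank function:
-- x is ranked above y iff rank y < rank x.
record LinOrd (n : ℕ) : Set where
  constructor linOrd
  field
    rank    : Fin n → Fin n
    rank-inj : Injective _≡_ _≡_ rank
open LinOrd public

_≻[_]_ : ∀ {n} → Fin n → LinOrd n → Fin n → Set
x ≻[ o ] y = toℕ (rank o y) < toℕ (rank o x)

reverseOrd : ∀ {n} → LinOrd n → LinOrd n
reverseOrd o = linOrd (λ x → opposite (rank o x))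
  (λ {x} {y} eq → rank-inj o
     (trans (sym (opposite-involutive (rank o x)))
            (trans (cong opposite eq) (opposite-involutive (rank o y)))))

Profile : ℕ → ℕ → Set
Profile n h = Fin h → LinOrd n

reverseProfile : ∀ {n h} → Profile n h → Profile n h
reverseProfile p i = reverseOrd (p i)

countAbove : ∀ {n h} → Profile n h → Fin n → Fin n → ℕ
countAbove {h = h} p y x =
  length (filter (λ i → toℕ (rank (p i) x) <? toℕ (rank (p i) y)) (allFin h))

InD : ∀ {n h} → ℕ → Profile n h → Fin n → Set
InD {n} μ p x = (y : Fin n) → countAbove p y x < μ

Admissible : ℕ → ℕ → Set
Admissible h μ = (h < 2 * μ) × (μ ≤ h)

IsMu : ∀ {n h} → Profile n h → ℕ → Set
IsMu {n} {h} p m =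
  Admissible h m × (∃ λ (x : Fin n) → InD m p x) ×
  ((μ : ℕ) → Admissible h μ → (∃ λ (x : Fin n) → InD μ p x) → m ≤ μ)

Odd : ℕ → Set
Odd h = ∃ λ k → h ≡ suc (2 * k)

module Submission where

-- Write m = n − 1, h = 2k + 1 and d = k − 1, so that h = 2d + 3.  Candidate n, the winner, is
-- ranked first by the k + 1 late voters and last by the k early ones; every voter ranks the other
-- m candidates cyclically, starting from a rotation that is constant on consecutive blocks of d
-- voters.  The hypothesis on h is exactly h ≤ m d, so there are enough rotations for all blocks.
-- In p at most k voters prefer any y to n, while n beats every other candidate k + 1 times: hence
-- μ(p) = k + 1, the least admissible value, and D = {n}.  In p^r at most k + 1 voters prefer any y
-- to n, and n is beaten k + 1 times; every other x is beaten by its cyclic predecessor, which p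
-- ranks below x except for the ≤ d voters whose rotation starts at x, so h − d = k + 2 times.
-- Hence μ(p^r) = k + 2 and again D = {n}.

open import Defs
open import Data.Bool using (true; false)
open import Data.Empty using (⊥-elim)
open import Data.Fin using (Fin; toℕ; zero; suc; fromℕ; fromℕ<; opposite)
import Data.Fin as Fin
open import Data.Fin.Properties
  using (toℕ-injective; toℕ-fromℕ<; toℕ-fromℕ; toℕ<n; opposite-prop; opposite-involutive)
open import Data.List using ([]; _∷_; length; filter; tabulate; allFin)
open import Data.List.Properties using (filter-≐; filter-accept; filter-reject; filter-none; length-tabulate)
open import Data.List.Relation.Binary.Sublist.Propositional using () renaming (⊆-refl to sublist-refl)
open import Data.List.Relation.Binary.Sublist.Propositional.Properties using (filter⁺; length-mono-≤)
open import Data.List.Relation.Unary.All.Properties using (tabulate⁺)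
open import Data.Nat
  using (ℕ; zero; suc; pred; _+_; _*_; _∸_; _<_; _≤_; z≤n; s≤s; s≤s⁻¹; z<s; _<?_; _≤?_; NonZero; >-nonZero)
open import Data.Nat.DivMod using (_/_; _%_; m/n*n≤m; m≡m%n+[m/n]*n; m%n<n; m<n*o⇒m/o<n)
open import Data.Nat.Properties
open import Data.Nat.Tactic.RingSolver using (solve)
open import Data.Product using (∃; _×_; _,_)
open import Data.Sum using (_⊎_; inj₁; inj₂)
open import Function using (_∘_; id)
open import Function.Bundles using (_⇔_; mk⇔; Equivalence)
open import Function.Properties.Equivalence using () renaming (trans to ⇔-trans)
open import Relation.Binary using (tri<; tri≈; tri>)
open import Relation.Binary.PropositionalEquality
open import Relation.Nullary using (yes; no; ¬_; does)
open import Relation.Nullary.Decidable using (_×-dec_)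
open import Relation.Unary using (Decidable; _⊆_; _≐_)
open import Relation.Unary.Properties using (∁?)

module _ {A : Set} {P : A → Set} (P? : Decidable P) where

  length-filter-∁ : ∀ xs → length (filter P? xs) + length (filter (∁? P?) xs) ≡ length xs
  length-filter-∁ [] = refl
  length-filter-∁ (x ∷ xs) with P? x
  ... | yes _ = cong suc (length-filter-∁ xs)
  ... | no _ = trans (+-suc _ _) (cong suc (length-filter-∁ xs))

  length-filter-tabulate-∘ : ∀ {B : Set} {h} (f : B → A) (g : Fin h → B) →
    length (filter P? (tabulate (f ∘ g))) ≡ length (filter (P? ∘ f) (tabulate g))
  length-filter-tabulate-∘ {h = zero} f g = refl
  length-filter-tabulate-∘ {h = suc h} f g with does (P? (f (g zero)))
  ... | true = cong suc (length-filter-tabulate-∘ f (g ∘ suc))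
  ... | false = length-filter-tabulate-∘ f (g ∘ suc)

count : ∀ {h} {P : Fin h → Set} → Decidable P → ℕ
count {h} P? = length (filter P? (allFin h))

module _ {h} {P Q : Fin h → Set} (P? : Decidable P) (Q? : Decidable Q) where

  count-≐ : P ≐ Q → count P? ≡ count Q?
  count-≐ P≐Q = cong length (filter-≐ P? Q? P≐Q (allFin h))

  count-mono : P ⊆ Q → count P? ≤ count Q?
  count-mono P⊆Q = length-mono-≤ (filter⁺ P? Q? (λ { refl Pa → P⊆Q Pa }) (sublist-refl {x = allFin h}))

count-∁ : ∀ {h} {P : Fin h → Set} (P? : Decidable P) → count P? + count (∁? P?) ≡ h
count-∁ {h} P? = trans (length-filter-∁ P? (allFin h)) (length-tabulate _)

count-none : ∀ {h} {P : Fin h → Set} (P? : Decidable P) → (∀ i → ¬ P i) → count P? ≡ 0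
count-none {h} P? ¬P = cong length (filter-none P? (tabulate⁺ ¬P))

module _ {h} {P : Fin (suc h) → Set} (P? : Decidable P) where

  count-accept : P zero → count P? ≡ suc (count (P? ∘ suc))
  count-accept P0 = trans (cong length (filter-accept P? P0)) (cong suc (length-filter-tabulate-∘ P? suc id))

  count-reject : ¬ P zero → count P? ≡ count (P? ∘ suc)
  count-reject ¬P0 = trans (cong length (filter-reject P? ¬P0)) (length-filter-tabulate-∘ P? suc id)

InInterval : ∀ {h} → ℕ → ℕ → Fin h → Set
InInterval a d i = a ≤ toℕ i × toℕ i < a + d

inInterval? : ∀ {h} a d → Decidable (InInterval {h} a d)
inInterval? a d i = (a ≤? toℕ i) ×-dec (toℕ i <? a + d)

count-interval : ∀ h a d → count (inInterval? {h} a d) ≤ d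
count-interval zero a d = z≤n
count-interval (suc h) (suc a) d = begin
  count I?                    ≡⟨ count-reject {h} I? (λ ()) ⟩
  count (I? ∘ suc)            ≡⟨ count-≐ {h} (I? ∘ suc) (inInterval? a d) shift ⟩
  count (inInterval? {h} a d) ≤⟨ count-interval h a d ⟩
  d                           ∎
  where
  open ≤-Reasoning
  I? : Decidable (InInterval {suc h} (suc a) d)
  I? = inInterval? (suc a) d
  shift : InInterval (suc a) d ∘ suc ≐ InInterval a d
  shift = (λ (le , lt) → s≤s⁻¹ le , s≤s⁻¹ lt) , (λ (le , lt) → s≤s le , s≤s lt)
count-interval (suc h) zero zero = ≤-reflexive (count-none (inInterval? {suc h} 0 0) (λ { _ (_ , ()) }))
count-interval (suc h) zero (suc d) = begin
  count I?                          ≡⟨ count-accept {h} I? (z≤n , z<s) ⟩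
  suc (count (I? ∘ suc))            ≡⟨ cong suc (count-≐ {h} (I? ∘ suc) (inInterval? 0 d) shift) ⟩
  suc (count (inInterval? {h} 0 d)) ≤⟨ s≤s (count-interval h 0 d) ⟩
  suc d                             ∎
  where
  open ≤-Reasoning
  I? : Decidable (InInterval {suc h} 0 (suc d))
  I? = inInterval? 0 (suc d)
  shift : InInterval 0 (suc d) ∘ suc ≐ InInterval {h} 0 d
  shift = (λ (_ , lt) → z≤n , s≤s⁻¹ lt) , (λ (_ , lt) → z≤n , s≤s lt)

module Rotation (m : ℕ) .{{_ : NonZero m}} where

  rot : ℕ → ℕ → ℕ
  rot t x with t ≤? x
  ... | yes _ = x ∸ t
  ... | no _  = x + m ∸ t

  rot-spec : ∀ {t} x → t < m → (t ≤ x × rot t x + t ≡ x) ⊎ (x < t × rot t x + t ≡ x + m)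
  rot-spec {t} x t<m with t ≤? x
  ... | yes t≤x = inj₁ (t≤x , m∸n+n≡m t≤x)
  ... | no t≰x  = inj₂ (≰⇒> t≰x , m∸n+n≡m (≤-trans (<⇒≤ t<m) (m≤n+m m x)))

  rot-< : ∀ {t x} → t < m → x < m → rot t x < m
  rot-< {t} {x} t<m x<m with rot-spec x t<m
  ... | inj₁ (_ , eq)   = ≤-<-trans (m≤m+n (rot t x) t) (subst (_< m) (sym eq) x<m)
  ... | inj₂ (x<t , eq) = +-cancelʳ-< t (rot t x) m
          (subst₂ _<_ (sym eq) (+-comm t m) (+-monoˡ-< m x<t))

  rot-injective : ∀ {t x y} → t < m → x < m → y < m → rot t x ≡ rot t y → x ≡ y
  rot-injective {t} {x} {y} t<m x<m y<m eq with rot-spec x t<m | rot-spec y t<m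
  ... | inj₁ (_ , ex) | inj₁ (_ , ey) = trans (sym ex) (trans (cong (_+ t) eq) ey)
  ... | inj₂ (_ , ex) | inj₂ (_ , ey) = +-cancelʳ-≡ m x y (trans (sym ex) (trans (cong (_+ t) eq) ey))
  ... | inj₁ (_ , ex) | inj₂ (_ , ey) =
    ⊥-elim (<⇒≱ x<m (subst (m ≤_) (trans (sym ey) (trans (cong (_+ t) (sym eq)) ex)) (m≤n+m m y)))
  ... | inj₂ (_ , ex) | inj₁ (_ , ey) =
    ⊥-elim (<⇒≱ y<m (subst (m ≤_) (trans (sym ex) (trans (cong (_+ t) eq) ey)) (m≤n+m m x)))

  cpred : ℕ → ℕ
  cpred zero    = pred m
  cpred (suc x) = x

  cpred-< : ∀ {x} → x < m → cpred x < m
  cpred-< {zero}  _   = ≤-reflexive (suc-pred m)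
  cpred-< {suc x} x<m = <-trans (n<1+n x) x<m

  cpred-≢ : ∀ {x} → 1 < m → cpred x ≢ x
  cpred-≢ {zero}  1<m eq = <-irrefl (sym (trans (sym (suc-pred m)) (cong suc eq))) 1<m
  cpred-≢ {suc x} _   eq = <-irrefl eq (n<1+n x)

  rot-cpred : ∀ {t} x → t < m → t ≢ x → rot t x ≡ suc (rot t (cpred x))
  rot-cpred {t} (suc x) t<m t≢x with rot-spec (suc x) t<m | rot-spec x t<m
  ... | inj₁ (_ , e) | inj₁ (_ , e') = +-cancelʳ-≡ t _ _ (trans e (cong suc (sym e')))
  ... | inj₂ (_ , e) | inj₂ (_ , e') = +-cancelʳ-≡ t _ _ (trans e (cong suc (sym e')))
  ... | inj₁ (t≤1+x , _) | inj₂ (x<t , _) = ⊥-elim (t≢x (≤-antisym t≤1+x x<t))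
  ... | inj₂ (1+x<t , _) | inj₁ (t≤x , _) = ⊥-elim (<-irrefl refl (≤-<-trans t≤x (<-trans (n<1+n x) 1+x<t)))
  rot-cpred {t} zero t<m t≢0 with rot-spec zero t<m | rot-spec (pred m) t<m
  ... | inj₁ (t≤0 , _) | _ = ⊥-elim (t≢0 (n≤0⇒n≡0 t≤0))
  ... | inj₂ (_ , e) | inj₁ (_ , e') = +-cancelʳ-≡ t _ _ (trans e (trans (sym (suc-pred m)) (cong suc (sym e'))))
  ... | inj₂ _ | inj₂ (pm<t , _) = ⊥-elim (<⇒≱ t<m (subst (_≤ t) (suc-pred m) pm<t))

  rot-cpred-< : ∀ {t x} → t < m → rot t x < rot t (cpred x) → t ≡ x
  rot-cpred-< {t} {x} t<m lt with t ≟ x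
  ... | yes t≡x = t≡x
  ... | no t≢x  = ⊥-elim (<-asym lt (subst (rot t (cpred x) <_) (sym (rot-cpred x t<m t≢x)) (n<1+n _)))

above? : ∀ {n h} (p : Profile n h) (y x : Fin n) → Decidable (λ i → y ≻[ p i ] x)
above? p y x i = toℕ (rank (p i) x) <? toℕ (rank (p i) y)

toℕ-opposite-< : ∀ {n} {a b : Fin n} → toℕ a < toℕ b → toℕ (opposite b) < toℕ (opposite a)
toℕ-opposite-< {n} {a} {b} a<b rewrite opposite-prop a | opposite-prop b = ∸-monoʳ-< (s≤s a<b) (toℕ<n b)

≻-reverseOrd : ∀ {n} (o : LinOrd n) {x y} → x ≻[ reverseOrd o ] y → y ≻[ o ] x
≻-reverseOrd o {x} {y} lt =
  subst₂ (λ a b → toℕ a < toℕ b) (opposite-involutive (rank o x)) (opposite-involutive (rank o y))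
    (toℕ-opposite-< lt)

≻-connex : ∀ {n} (o : LinOrd n) {x y} → x ≢ y → x ≻[ o ] y ⊎ y ≻[ o ] x
≻-connex o {x} {y} x≢y with <-cmp (toℕ (rank o y)) (toℕ (rank o x))
... | tri< y<x _ _ = inj₁ y<x
... | tri≈ _ eq _  = ⊥-elim (x≢y (rank-inj o (toℕ-injective (sym eq))))
... | tri> _ _ x<y = inj₂ x<y

module _ {n h} (p : Profile n h) where

  countAbove-reverse : ∀ y x → countAbove (reverseProfile p) y x ≡ countAbove p x y
  countAbove-reverse y x = count-≐ (above? (reverseProfile p) y x) (above? p x y)
    (≻-reverseOrd (p _) , toℕ-opposite-<)

  countAbove-complement : ∀ {x y} → x ≢ y → countAbove p x y + countAbove p y x ≡ h
  countAbove-complement {x} {y} x≢y =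
    trans (cong (countAbove p x y +_) (count-≐ (above? p y x) (∁? (above? p x y)) (<-asym , ≯⇒≻)))
          (count-∁ (above? p x y))
    where
    ≯⇒≻ : ∀ {i} → ¬ x ≻[ p i ] y → y ≻[ p i ] x
    ≯⇒≻ {i} x≯y with ≻-connex (p i) x≢y
    ... | inj₁ x≻y = ⊥-elim (x≯y x≻y)
    ... | inj₂ y≻x = y≻x

  countAbove-majority : ∀ {x y c e} → x ≢ y → countAbove p y x ≤ c → c + e ≡ h → e ≤ countAbove p x y
  countAbove-majority {x} {y} {c} {e} x≢y few c+e≡h = +-cancelˡ-≤ c e (countAbove p x y) (begin
    c + e                                 ≡⟨ trans c+e≡h (sym (countAbove-complement x≢y)) ⟩
    countAbove p x y + countAbove p y x   ≤⟨ +-monoʳ-≤ (countAbove p x y) few ⟩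
    countAbove p x y + c                  ≡⟨ +-comm (countAbove p x y) c ⟩
    c + countAbove p x y                  ∎)
    where open ≤-Reasoning

module _ {n} (f : ℕ → ℕ) (f-< : ∀ {x} → x < n → f x < n)
         (f-injective : ∀ {x y} → x < n → y < n → f x ≡ f y → x ≡ y) where

  ranking : LinOrd n
  ranking = linOrd (λ x → fromℕ< (f-< (toℕ<n x))) λ {x} {y} eq → toℕ-injective
    (f-injective (toℕ<n x) (toℕ<n y)
      (trans (sym (toℕ-fromℕ< (f-< (toℕ<n x)))) (trans (cong toℕ eq) (toℕ-fromℕ< (f-< (toℕ<n y))))))

  ≻-ranking : ∀ {x y} → x ≻[ ranking ] y → f (toℕ y) < f (toℕ x)
  ≻-ranking {x} {y} = subst₂ _<_ (toℕ-fromℕ< (f-< (toℕ<n y))) (toℕ-fromℕ< (f-< (toℕ<n x)))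

admissible : ∀ {k μ} → suc k ≤ μ → μ ≤ suc (2 * k) → Admissible (suc (2 * k)) μ
admissible {k} {μ} k<μ μ≤h = ≤-trans (≤-reflexive (sym (*-suc 2 k))) (*-monoʳ-≤ 2 k<μ) , μ≤h

admissible⇒> : ∀ {k μ} → Admissible (suc (2 * k)) μ → suc k ≤ μ
admissible⇒> {k} (h<2μ , _) = *-cancelˡ-≤ 2 (≤-trans (≤-reflexive (*-suc 2 k)) h<2μ)

D-singleton : ∀ {n h μ} {p : Profile n h} {s : Fin n} → InD μ p s → (∀ {x} → x ≢ s → ¬ InD μ p x) →
  ∀ x → InD μ p x ⇔ (x ≡ s)
D-singleton {μ = μ} {p} {s} s∈D others∉D x = mk⇔ to λ { refl → s∈D }
  where
  to : InD μ p x → x ≡ s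
  to x∈D with x Fin.≟ s
  ... | yes x≡s = x≡s
  ... | no x≢s  = ⊥-elim (others∉D x≢s x∈D)

module Construction (m d : ℕ) .{{_ : NonZero d}} (1<m : 1 < m) (fits : suc (2 * suc d) ≤ m * d) where

  open Rotation m {{>-nonZero (<-trans z<s 1<m)}}

  k : ℕ
  k = suc d

  h : ℕ
  h = suc (2 * k)

  block : ℕ → ℕ
  block i = i / d

  block-< : ∀ {i} → i < h → block i < m
  block-< i<h = m<n*o⇒m/o<n (<-≤-trans i<h fits)

  block-interval : ∀ {i x} → block i ≡ x → x * d ≤ i × i < x * d + d
  block-interval {i} refl = m/n*n≤m i d , (begin-strict
    i                       ≡⟨ m≡m%n+[m/n]*n i d ⟩
    i % d + block i * d     <⟨ +-monoˡ-< (block i * d) (m%n<n i d) ⟩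
    d + block i * d         ≡⟨ +-comm d _ ⟩
    block i * d + d         ∎)
    where open ≤-Reasoning

  ballot : ℕ → ℕ → ℕ
  ballot i x with x <? m | k ≤? i
  ... | yes _ | yes _ = rot (block i) x
  ... | yes _ | no _  = suc (rot (block i) x)
  ... | no _  | yes _ = m
  ... | no _  | no _  = 0

  ballot-late : ∀ {i x} → k ≤ i → x < m → ballot i x ≡ rot (block i) x
  ballot-late {i} {x} k≤i x<m with x <? m | k ≤? i
  ... | yes _ | yes _   = refl
  ... | yes _ | no k≰i  = ⊥-elim (k≰i k≤i)
  ... | no x≮m | _      = ⊥-elim (x≮m x<m)

  ballot-early : ∀ {i x} → i < k → x < m → ballot i x ≡ suc (rot (block i) x)
  ballot-early {i} {x} i<k x<m with x <? m | k ≤? i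
  ... | yes _ | yes k≤i = ⊥-elim (<⇒≱ i<k k≤i)
  ... | yes _ | no _    = refl
  ... | no x≮m | _      = ⊥-elim (x≮m x<m)

  ballot-late-last : ∀ {i} → k ≤ i → ballot i m ≡ m
  ballot-late-last {i} k≤i with m <? m | k ≤? i
  ... | yes m<m | _     = ⊥-elim (<-irrefl refl m<m)
  ... | no _ | yes _    = refl
  ... | no _ | no k≰i   = ⊥-elim (k≰i k≤i)

  ballot-early-last : ∀ {i} → i < k → ballot i m ≡ 0
  ballot-early-last {i} i<k with m <? m | k ≤? i
  ... | yes m<m | _     = ⊥-elim (<-irrefl refl m<m)
  ... | no _ | yes k≤i  = ⊥-elim (<⇒≱ i<k k≤i)
  ... | no _ | no _     = refl

  ≮⇒≡m : ∀ {x} → x < suc m → ¬ x < m → x ≡ m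
  ≮⇒≡m x<1+m x≮m = ≤-antisym (s≤s⁻¹ x<1+m) (≮⇒≥ x≮m)

  ballot-< : ∀ {i x} → i < h → x < suc m → ballot i x < suc m
  ballot-< {i} {x} i<h _ with x <? m | k ≤? i
  ... | yes x<m | yes _ = m<n⇒m<1+n (rot-< (block-< i<h) x<m)
  ... | yes x<m | no _  = s≤s (rot-< (block-< i<h) x<m)
  ... | no _    | yes _ = n<1+n m
  ... | no _    | no _  = z<s

  ballot-injective : ∀ {i x y} → i < h → x < suc m → y < suc m → ballot i x ≡ ballot i y → x ≡ y
  ballot-injective {i} {x} {y} i<h x<1+m y<1+m eq with x <? m | y <? m | k ≤? i
  ... | yes x<m | yes y<m | yes _ = rot-injective (block-< i<h) x<m y<m eq
  ... | yes x<m | yes y<m | no _  = rot-injective (block-< i<h) x<m y<m (suc-injective eq)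
  ... | yes x<m | no _    | yes _ = ⊥-elim (<-irrefl eq (rot-< (block-< i<h) x<m))
  ... | yes _   | no _    | no _  = ⊥-elim (1+n≢0 eq)
  ... | no _    | yes y<m | yes _ = ⊥-elim (<-irrefl (sym eq) (rot-< (block-< i<h) y<m))
  ... | no _    | yes _   | no _  = ⊥-elim (1+n≢0 (sym eq))
  ... | no x≮m  | no y≮m  | _     = trans (≮⇒≡m x<1+m x≮m) (sym (≮⇒≡m y<1+m y≮m))

  ballot-above-last : ∀ {i y} → i < h → y < suc m → ballot i m < ballot i y → i < k
  ballot-above-last {i} {y} i<h y<1+m lt = ≰⇒> λ k≤i →
    <⇒≱ (subst (_< ballot i y) (ballot-late-last k≤i) lt) (s≤s⁻¹ (ballot-< i<h y<1+m))

  ballot-below-last : ∀ {i y} → ballot i y < ballot i m → k ≤ i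
  ballot-below-last {i} {y} lt = ≮⇒≥ λ i<k → n≮0 (subst (ballot i y <_) (ballot-early-last i<k) lt)

  ballot-cpred : ∀ {i x} → i < h → x < m → ballot i x < ballot i (cpred x) → block i ≡ x
  ballot-cpred {i} {x} i<h x<m lt = rot-cpred-< (block-< i<h) rot-lt
    where
    rot-lt : rot (block i) x < rot (block i) (cpred x)
    rot-lt with ≤-<-connex k i
    ... | inj₁ k≤i = subst₂ _<_ (ballot-late k≤i x<m) (ballot-late k≤i (cpred-< x<m)) lt
    ... | inj₂ i<k = s≤s⁻¹ (subst₂ _<_ (ballot-early i<k x<m) (ballot-early i<k (cpred-< x<m)) lt)

  k+1+k≡h : suc d + suc (suc d) ≡ suc (2 * suc d)
  k+1+k≡h = solve (d ∷ [])

  d+2+k≡h : d + suc (suc (suc d)) ≡ suc (2 * suc d)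
  d+2+k≡h = solve (d ∷ [])

  voters : Profile (suc m) h
  voters i = ranking (ballot (toℕ i)) (ballot-< (toℕ<n i)) (ballot-injective (toℕ<n i))

  ≻-voters : ∀ {i x y} → x ≻[ voters i ] y → ballot (toℕ i) (toℕ y) < ballot (toℕ i) (toℕ x)
  ≻-voters {i} = ≻-ranking (ballot (toℕ i)) (ballot-< (toℕ<n i)) (ballot-injective (toℕ<n i))

  winner : Fin (suc m)
  winner = fromℕ m

  ≡winner⇔ : ∀ x → (x ≡ winner) ⇔ (toℕ x ≡ m)
  ≡winner⇔ x = mk⇔ (λ { refl → toℕ-fromℕ m }) (λ eq → toℕ-injective (trans eq (sym (toℕ-fromℕ m))))

  ≢winner⇒< : ∀ {x} → x ≢ winner → toℕ x < m
  ≢winner⇒< {x} x≢w = ≤∧≢⇒< (s≤s⁻¹ (toℕ<n x)) (x≢w ∘ Equivalence.from (≡winner⇔ x))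

  above-winner⇒early : ∀ {i y} → y ≻[ voters i ] winner → InInterval 0 k i
  above-winner⇒early {i} {y} lt = z≤n , ballot-above-last (toℕ<n i) (toℕ<n y)
    (subst (λ w → ballot (toℕ i) w < ballot (toℕ i) (toℕ y)) (toℕ-fromℕ m) (≻-voters lt))

  winner-above⇒late : ∀ {i y} → winner ≻[ voters i ] y → InInterval k (suc k) i
  winner-above⇒late {i} {y} lt = ballot-below-last
    (subst (λ w → ballot (toℕ i) (toℕ y) < ballot (toℕ i) w) (toℕ-fromℕ m) (≻-voters lt))
    , subst (toℕ i <_) (sym k+1+k≡h) (toℕ<n i)

  predecessor : (x : Fin (suc m)) → toℕ x < m → Fin (suc m)
  predecessor x x<m = fromℕ< (m<n⇒m<1+n (cpred-< x<m))

  toℕ-predecessor : ∀ {x} (x<m : toℕ x < m) → toℕ (predecessor x x<m) ≡ cpred (toℕ x)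
  toℕ-predecessor x<m = toℕ-fromℕ< (m<n⇒m<1+n (cpred-< x<m))

  predecessor-≢ : ∀ {x} (x<m : toℕ x < m) → predecessor x x<m ≢ x
  predecessor-≢ x<m eq = cpred-≢ 1<m (trans (sym (toℕ-predecessor x<m)) (cong toℕ eq))

  predecessor-above⇒block : ∀ {i x} (x<m : toℕ x < m) → predecessor x x<m ≻[ voters i ] x →
    InInterval (toℕ x * d) d i
  predecessor-above⇒block {i} {x} x<m lt = block-interval (ballot-cpred (toℕ<n i) x<m
    (subst (λ z → ballot (toℕ i) (toℕ x) < ballot (toℕ i) z) (toℕ-predecessor x<m) (≻-voters lt)))

  few-rank-above-winner : ∀ y → countAbove voters y winner ≤ k
  few-rank-above-winner y = ≤-trans (count-mono (above? voters y winner) (inInterval? 0 k) above-winner⇒early)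
    (count-interval h 0 k)

  few-rank-winner-above : ∀ y → countAbove voters winner y ≤ suc k
  few-rank-winner-above y = ≤-trans (count-mono (above? voters winner y) (inInterval? k (suc k)) winner-above⇒late)
    (count-interval h k (suc k))

  few-rank-predecessor-above : ∀ {x} (x<m : toℕ x < m) → countAbove voters (predecessor x x<m) x ≤ d
  few-rank-predecessor-above {x} x<m = ≤-trans
    (count-mono (above? voters (predecessor x x<m) x) (inInterval? (toℕ x * d) d) (predecessor-above⇒block x<m))
    (count-interval h (toℕ x * d) d)

  winner∈D : InD (suc k) voters winner
  winner∈D y = s≤s (few-rank-above-winner y)

  winner-beats : ∀ {x} → x ≢ winner → suc k ≤ countAbove voters winner x
  winner-beats {x} x≢w = countAbove-majority voters (x≢w ∘ sym) (few-rank-above-winner x) k+1+k≡h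

  others∉D : ∀ {x} → x ≢ winner → ¬ InD (suc k) voters x
  others∉D x≢w x∈D = <⇒≱ (x∈D winner) (winner-beats x≢w)

  reversed : Profile (suc m) h
  reversed = reverseProfile voters

  winner∈Dʳ : InD (suc (suc k)) reversed winner
  winner∈Dʳ y = s≤s (subst (_≤ suc k) (sym (countAbove-reverse voters y winner)) (few-rank-winner-above y))

  predecessor-beatsʳ : ∀ {x} (x≢w : x ≢ winner) →
    suc (suc k) ≤ countAbove reversed (predecessor x (≢winner⇒< x≢w)) x
  predecessor-beatsʳ {x} x≢w = subst (suc (suc k) ≤_) (sym (countAbove-reverse voters _ x))
    (countAbove-majority voters (predecessor-≢ x<m ∘ sym) (few-rank-predecessor-above x<m) d+2+k≡h)
    where x<m = ≢winner⇒< x≢w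

  others∉Dʳ : ∀ {x} → x ≢ winner → ¬ InD (suc (suc k)) reversed x
  others∉Dʳ x≢w x∈D = <⇒≱ (x∈D _) (predecessor-beatsʳ x≢w)

  zero≢winner : zero ≢ winner
  zero≢winner eq = <-irrefl (trans (cong toℕ eq) (toℕ-fromℕ m)) (<-trans z<s 1<m)

  zero-beatsʳ : suc k ≤ countAbove reversed zero winner
  zero-beatsʳ = subst (suc k ≤_) (sym (countAbove-reverse voters zero winner)) (winner-beats zero≢winner)

  μ-voters : IsMu voters (suc k)
  μ-voters = admissible ≤-refl (s≤s (m≤m+n k _)) , (winner , winner∈D) , λ _ adm _ → admissible⇒> adm

  μ-reversed : IsMu reversed (suc (suc k))
  μ-reversed =
    admissible (n≤1+n _) (subst (suc (suc k) ≤_) d+2+k≡h (m≤n+m _ d)) , (winner , winner∈Dʳ) , minimal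
    where
    minimal : ∀ μ → Admissible h μ → ∃ (λ x → InD μ reversed x) → suc (suc k) ≤ μ
    minimal μ _ (x , x∈D) with x Fin.≟ winner
    ... | yes refl = ≤-<-trans zero-beatsʳ (x∈D zero)
    ... | no x≢w   = <⇒≤ (≤-<-trans (predecessor-beatsʳ x≢w) (x∈D _))

  D-voters : ∀ x → InD (suc k) voters x ⇔ (toℕ x ≡ m)
  D-voters x = ⇔-trans (D-singleton {p = voters} winner∈D others∉D x) (≡winner⇔ x)

  D-reversed : ∀ x → InD (suc (suc k)) reversed x ⇔ (toℕ x ≡ m)
  D-reversed x = ⇔-trans (D-singleton {p = reversed} winner∈Dʳ others∉Dʳ x) (≡winner⇔ x)

few-voters : ∀ a {k} → k ≤ 1 → ¬ 3 * (3 + a) ≤ suc (2 * k) * (1 + a)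
few-voters a k≤1 hyp = <⇒≱ (*-monoʳ-< 3 (s≤s (s≤s (n≤1+n a))))
  (≤-trans hyp (*-monoˡ-≤ (1 + a) (s≤s (*-monoʳ-≤ 2 k≤1))))

-- With X = a + b + ab the hypothesis reads 9 + 3a ≤ 5 + 3a + 2X, and the claim 5 + 2b ≤ 3 + 2b + X.
blocks-fit : ∀ a b → 3 * (3 + a) ≤ suc (2 * (2 + b)) * (1 + a) → suc (2 * (2 + b)) ≤ (3 + a) * (1 + b)
blocks-fit a b hyp = begin
  suc (2 * (2 + b))           ≡⟨ solve (b ∷ []) ⟩
  3 + 2 * b + 2               ≤⟨ +-monoʳ-≤ (3 + 2 * b) 2≤X ⟩
  3 + 2 * b + (a + b + a * b) ≡⟨ solve (a ∷ b ∷ []) ⟩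
  (3 + a) * (1 + b)           ∎
  where
  open ≤-Reasoning
  hyp-lhs : 3 * (3 + a) ≡ 5 + 3 * a + 4
  hyp-lhs = solve (a ∷ [])
  hyp-rhs : suc (2 * (2 + b)) * (1 + a) ≡ 5 + 3 * a + 2 * (a + b + a * b)
  hyp-rhs = solve (a ∷ b ∷ [])
  2≤X : 2 ≤ a + b + a * b
  2≤X = *-cancelˡ-≤ 2 (+-cancelˡ-≤ (5 + 3 * a) 4 _ (subst₂ _≤_ hyp-lhs hyp-rhs hyp))

proposition23 : (n h : ℕ) → 4 ≤ n → Odd h → 3 * (n ∸ 1) ≤ h * (n ∸ 3) →
    ∃ λ (p : Profile n h) → ∃ λ (m : ℕ) → ∃ λ (m' : ℕ) →
      IsMu p m × IsMu (reverseProfile p) m' ×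
      ((x : Fin n) → InD m p x ⇔ (toℕ x ≡ n ∸ 1)) ×
      ((x : Fin n) → InD m' (reverseProfile p) x ⇔ (toℕ x ≡ n ∸ 1))
proposition23 _ _ (s≤s (s≤s (s≤s (s≤s {n = a} z≤n)))) (zero , refl) hyp =
  ⊥-elim (few-voters a z≤n hyp)
proposition23 _ _ (s≤s (s≤s (s≤s (s≤s {n = a} z≤n)))) (suc zero , refl) hyp =
  ⊥-elim (few-voters a (s≤s z≤n) hyp)
proposition23 _ _ (s≤s (s≤s (s≤s (s≤s {n = a} z≤n)))) (suc (suc b) , refl) hyp =
  voters , suc k , suc (suc k) , μ-voters , μ-reversed , D-voters , D-reversed
  where open Construction (3 + a) (suc b) (s≤s (s≤s z≤n)) (blocks-fit a b hyp)
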